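{- Let $s\ge1$, $S=\{0,1,\dots,s-1\}$, $n\ge1$, and let $I$ be a distance-compatible mapping on $S^n$. Then $I$ is computed by an in situ program with signature $1,2,\dots,n$, namely the program $(p_1,1),(p_2,2),\dots,(p_n,n)$ where, for every $(x_1,\dots,x_n)\in S^n$ with $I(x_1,\dots,x_n)=(y_1,\dots,y_n)$ and every $i=1,\dots,n$, $$p_i(y_1,\dots,y_{i-1},x_i,\dots,x_n)=y_i$$ (this condition well defines $p_i$ on all vectors that occur, its values elsewhere being arbitrary).
   Context: An in situ program of a mapping $E:S^n\to S^n$ is a finite sequence $(\psi_1,i_1),\dots,(\psi_m,i_m)$ with $\psi_k:S^n\to S$ and $i_k\in\{1,\dots,n\}$ such that for every $X\in S^n$, setting $X_0=X$ and letting $X_k$ be the vector equal to $X_{k-1}$ except that its $i_k$-th component is replaced by $\psi_k(X_{k-1})$, one has $X_m=E(X)$; its signature is $i_1,\dots,i_m$. The index of $(x_1,\dots,x_n)\in S^n$ is $x_1+s x_2+\dots+s^{n-1}x_n\in\{0,\dots,s^n-1\}$, and $X_i$ denotes the vector of index $i$. The distance of $X_a,X_b$ is $\Delta(X_a,X_b)=|b-a|$. A mapping $I$ on $S^n$ is distance-compatible if $\Delta(I(x),I(y))\le\Delta(x,y)$ for all $x,y\in S^n$ (equivalently $\Delta(I(X_a),I(X_{a+1}))\le1$ for all $0\le a<s^n-1$). -}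

module Defs where

open import Data.Nat using (ℕ; zero; suc; _+_; _*_; _≤_; _<_; ∣_-_∣)
open import Data.Fin using (Fin; toℕ)
open import Data.Vec using (Vec; []; _∷_; _[_]≔_; lookup; tabulate; allFin)
open import Data.List using (List; map; foldl)
open import Data.Product using (_×_; _,_; proj₂)
open import Data.Bool using (if_then_else_)
open import Data.Nat using (_<ᵇ_)
open import Relation.Binary.PropositionalEquality using (_≡_)

-- S = {0,...,s-1} is Fin s; S^n is Vec (Fin s) n.
-- Components are 0-based: Fin n index j stands for the paper's coordinate j+1.

index : {s n : ℕ} → Vec (Fin s) n → ℕ
index {s} []       = 0
index {s} (x ∷ xs) = toℕ x + s * index xs

Δ : {s n : ℕ} → Vec (Fin s) n → Vec (Fin s) n → ℕ
Δ x y = ∣ index x - index y ∣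

DistanceCompatible : {s n : ℕ} → (Vec (Fin s) n → Vec (Fin s) n) → Set
DistanceCompatible I = ∀ x y → Δ (I x) (I y) ≤ Δ x y

InSituProgram : ℕ → ℕ → Set
InSituProgram s n = List ((Vec (Fin s) n → Fin s) × Fin n)

step : {s n : ℕ} → Vec (Fin s) n → (Vec (Fin s) n → Fin s) × Fin n → Vec (Fin s) n
step X (ψ , i) = X [ i ]≔ ψ X

run : {s n : ℕ} → InSituProgram s n → Vec (Fin s) n → Vec (Fin s) n
run P X = foldl step X P

signature : {s n : ℕ} → InSituProgram s n → List (Fin n)
signature P = map proj₂ P

Computes : {s n : ℕ} → InSituProgram s n → (Vec (Fin s) n → Vec (Fin s) n) → Set
Computes P E = ∀ X → run P X ≡ E X

coords : (n : ℕ) → List (Fin n)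
coords n = Data.Vec.toList (allFin n)

sweepProgram : {s n : ℕ} → (Fin n → Vec (Fin s) n → Fin s) → InSituProgram s n
sweepProgram {n = n} p = map (λ i → (p i , i)) (coords n)

mix : {s n : ℕ} → Fin n → Vec (Fin s) n → Vec (Fin s) n → Vec (Fin s) n
mix i x y = tabulate (λ j → if toℕ j <ᵇ toℕ i then lookup y j else lookup x j)

-- If mix k x (I x) = mix k x' (I x'), then x and x' agree from coordinate k on, so
-- their indices lie in one block of s^k consecutive integers; by distance compatibility
-- the indices of I x and I x' differ by less than s^k, and since I x and I x' agree below
-- k, they are equal. Hence p_k is well defined on the vectors mix k x (I x), and the
-- program (p_1,1),...,(p_n,n) turns mix k x (I x) into mix (k+1) x (I x) at step k,
-- leading from x = mix 0 x (I x) to mix n x (I x) = I x.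
module Submission where

open import Defs
open import Data.Nat using (ℕ; _≤_)
open import Data.Fin using (Fin)
open import Data.Vec using (Vec; lookup)
open import Data.List using (List)
open import Data.Product using (Σ; _×_)
open import Relation.Binary.PropositionalEquality using (_≡_)

open import Data.Nat using (zero; suc; _+_; _*_; _^_; _<_; z≤n; s≤s; z<s; ∣_-_∣; _<ᵇ_; NonZero)
open import Data.Nat.Properties
open import Data.Nat.DivMod using (_%_; [m+kn]%n≡m%n; m<n⇒m%n≡m)
open import Data.Nat.Tactic.RingSolver using (solve-∀)
open import Data.Fin as F using (toℕ)
open import Data.Fin.Properties using (toℕ<n; toℕ-injective; any?)
open import Data.Vec as V using ([]; _∷_; _[_]≔_; tabulate; toList)
open import Data.Vec.Properties using (lookup∘tabulate; ≡-dec; lookup∘update; lookup∘update′)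
open import Data.Vec.Relation.Binary.Pointwise.Extensional using (ext; Pointwise-≡⇒≡)
open import Data.List as L using (foldl)
open import Data.List.Properties using (map-∘; map-id)
open import Data.Product using (∃-syntax; _,_)
open import Data.Bool using (true; false; if_then_else_; T)
open import Data.Empty using (⊥-elim)
open import Relation.Nullary using (Dec; yes; no)
open import Relation.Binary using (tri<; tri≈; tri>)
open import Relation.Binary.PropositionalEquality using (refl; sym; trans; cong; cong₂; subst; module ≡-Reasoning)

lookup-extensionality : ∀ {A : Set} {m} {u v : Vec A m} → (∀ j → lookup u j ≡ lookup v j) → u ≡ v
lookup-extensionality h = Pointwise-≡⇒≡ (ext h)

∃-Vec? : ∀ {s} m (P : Vec (Fin s) m → Set) → (∀ v → Dec (P v)) → Dec (∃[ v ] P v)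
∃-Vec? zero P P? with P? []
... | yes p = yes ([] , p)
... | no ¬p = no λ { ([] , p) → ¬p p }
∃-Vec? (suc m) P P? with any? (λ a → ∃-Vec? m (λ vs → P (a ∷ vs)) (λ vs → P? (a ∷ vs)))
... | yes (a , vs , p) = yes (a ∷ vs , p)
... | no ¬p = no λ { (a ∷ vs , p) → ¬p (a , vs , p) }

InWindow : ℕ → ℕ → ℕ → Set
InWindow H P x = ∃[ a ] a < P × x ≡ H + a

InWindow⇒∣-∣< : ∀ {H P x y} → InWindow H P x → InWindow H P y → ∣ x - y ∣ < P
InWindow⇒∣-∣< {H} (a , a<P , refl) (b , b<P , refl) =
  subst (_< _) (sym (∣m+n-m+o∣≡∣n-o∣ H a b)) (≤-<-trans (∣m-n∣≤m⊔n a b) (⊔-lub a<P b<P))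

prepend-digit : ∀ c s H d → c + s * (H + d) ≡ s * H + (c + s * d)
prepend-digit = solve-∀

-- mix′ k x y is mix i x y for toℕ i = k; indexing by ℕ lets k run up to n.
mix′ : ∀ {A : Set} {n} → ℕ → Vec A n → Vec A n → Vec A n
mix′ k x y = tabulate (λ j → if toℕ j <ᵇ k then lookup y j else lookup x j)

module _ {A : Set} {n : ℕ} where

  lookup-mix′-≥ : ∀ k (x y : Vec A n) j → k ≤ toℕ j → lookup (mix′ k x y) j ≡ lookup x j
  lookup-mix′-≥ k x y j k≤j rewrite lookup∘tabulate (λ j → if toℕ j <ᵇ k then lookup y j else lookup x j) j
    with toℕ j <ᵇ k in e
  ... | true  = ⊥-elim (<⇒≱ (<ᵇ⇒< (toℕ j) k (subst T (sym e) _)) k≤j)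
  ... | false = refl

  lookup-mix′-< : ∀ k (x y : Vec A n) j → toℕ j < k → lookup (mix′ k x y) j ≡ lookup y j
  lookup-mix′-< k x y j j<k rewrite lookup∘tabulate (λ j → if toℕ j <ᵇ k then lookup y j else lookup x j) j
    with toℕ j <ᵇ k in e
  ... | true  = refl
  ... | false = ⊥-elim (subst T e (<⇒<ᵇ j<k))

  mix′-zero : ∀ (x y : Vec A n) → mix′ 0 x y ≡ x
  mix′-zero x y = lookup-extensionality (λ j → lookup-mix′-≥ 0 x y j z≤n)

  mix′-≥ : ∀ k (x y : Vec A n) → n ≤ k → mix′ k x y ≡ y
  mix′-≥ k x y n≤k = lookup-extensionality (λ j → lookup-mix′-< k x y j (<-≤-trans (toℕ<n j) n≤k))

  mix′-update : ∀ k (x y : Vec A n) i → toℕ i ≡ k → mix′ k x y [ i ]≔ lookup y i ≡ mix′ (suc k) x y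
  mix′-update k x y i i≡k = lookup-extensionality at
    where
    at : ∀ j → lookup (mix′ k x y [ i ]≔ lookup y i) j ≡ lookup (mix′ (suc k) x y) j
    at j with j F.≟ i
    ... | yes refl = trans (lookup∘update j (mix′ k x y) (lookup y j))
                           (sym (lookup-mix′-< (suc k) x y j (s≤s (≤-reflexive i≡k))))
    ... | no j≢i with <-cmp (toℕ j) k
    ...   | tri< j<k _ _ = trans (lookup∘update′ j≢i (mix′ k x y) (lookup y i))
                                 (trans (lookup-mix′-< k x y j j<k) (sym (lookup-mix′-< (suc k) x y j (m<n⇒m<1+n j<k))))
    ...   | tri≈ _ j≡k _ = ⊥-elim (j≢i (toℕ-injective (trans j≡k (sym i≡k))))
    ...   | tri> _ _ k<j = trans (lookup∘update′ j≢i (mix′ k x y) (lookup y i))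
                                 (trans (lookup-mix′-≥ k x y j (<⇒≤ k<j)) (sym (lookup-mix′-≥ (suc k) x y j k<j)))

module _ {s : ℕ} .{{_ : NonZero s}} where

  low-digit : ∀ {a} i → a < s → (a + s * i) % s ≡ a
  low-digit {a} i a<s = begin
    (a + s * i) % s  ≡⟨ cong (λ t → (a + t) % s) (*-comm s i) ⟩
    (a + i * s) % s  ≡⟨ [m+kn]%n≡m%n a i s ⟩
    a % s            ≡⟨ m<n⇒m%n≡m a<s ⟩
    a                ∎
    where open ≡-Reasoning

  index-injective : ∀ {m} {u v : Vec (Fin s) m} → index u ≡ index v → u ≡ v
  index-injective {u = []} {[]} _ = refl
  index-injective {u = a ∷ as} {b ∷ bs} eq = cong₂ _∷_ (toℕ-injective a≡b) (index-injective as≡bs)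
    where
    a≡b : toℕ a ≡ toℕ b
    a≡b = trans (sym (low-digit (index as) (toℕ<n a))) (trans (cong (_% s) eq) (low-digit (index bs) (toℕ<n b)))
    as≡bs : index as ≡ index bs
    as≡bs = *-cancelˡ-≡ _ _ s (+-cancelˡ-≡ (toℕ a) _ _ (trans eq (cong (_+ s * index bs) (sym a≡b))))

  AgreeFrom AgreeBelow : ∀ {m} → ℕ → Vec (Fin s) m → Vec (Fin s) m → Set
  AgreeFrom  k u v = ∀ j → k ≤ toℕ j → lookup u j ≡ lookup v j
  AgreeBelow k u v = ∀ j → toℕ j < k → lookup u j ≡ lookup v j

  AgreeFrom⇒commonWindow : ∀ {m} k (u v : Vec (Fin s) m) → AgreeFrom k u v →
                           ∃[ H ] InWindow H (s ^ k) (index u) × InWindow H (s ^ k) (index v)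
  AgreeFrom⇒commonWindow zero u v agree with lookup-extensionality {u = u} {v} (λ j → agree j z≤n)
  ... | refl = index u , (0 , z<s , sym (+-identityʳ _)) , (0 , z<s , sym (+-identityʳ _))
  AgreeFrom⇒commonWindow (suc k) [] [] _ = 0 , (0 , m^n>0 s (suc k) , refl) , (0 , m^n>0 s (suc k) , refl)
  AgreeFrom⇒commonWindow (suc k) (a ∷ as) (b ∷ bs) agree
    with AgreeFrom⇒commonWindow k as bs (λ j k≤j → agree (F.suc j) (s≤s k≤j))
  ... | H , wa , wb = s * H , prepend a wa , prepend b wb
    where
    prepend : ∀ {x} (c : Fin s) → InWindow H (s ^ k) x → InWindow (s * H) (s ^ suc k) (toℕ c + s * x)
    prepend c (d , d<P , refl) = toℕ c + s * d , bound , prepend-digit (toℕ c) s H d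
      where
      bound : toℕ c + s * d < s * s ^ k
      bound = ≤-trans (+-monoˡ-≤ (s * d) (toℕ<n c))
                      (≤-trans (≤-reflexive (sym (*-suc s d))) (*-monoʳ-≤ s d<P))

  AgreeBelow∧∣index-index∣<⇒≡ : ∀ {m} k (u v : Vec (Fin s) m) → AgreeBelow k u v →
                                 ∣ index u - index v ∣ < s ^ k → u ≡ v
  AgreeBelow∧∣index-index∣<⇒≡ zero u v _ close = index-injective (∣m-n∣≡0⇒m≡n (n<1⇒n≡0 close))
  AgreeBelow∧∣index-index∣<⇒≡ (suc k) [] [] _ _ = refl
  AgreeBelow∧∣index-index∣<⇒≡ (suc k) (a ∷ as) (b ∷ bs) agree close with agree F.zero z<s
  ... | refl = cong (a ∷_) (AgreeBelow∧∣index-index∣<⇒≡ k as bs (λ j j<k → agree (F.suc j) (s≤s j<k))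
                                                       (*-cancelˡ-< s _ _ scaled))
    where
    scaled : s * ∣ index as - index bs ∣ < s * s ^ k
    scaled = subst (_< s * s ^ k)
      (trans (∣m+n-m+o∣≡∣n-o∣ (toℕ a) (s * index as) (s * index bs)) (sym (*-distribˡ-∣-∣ s (index as) (index bs))))
      close

  module _ {n : ℕ} (I : Vec (Fin s) n → Vec (Fin s) n) where

    mix′-image-injective : DistanceCompatible I → ∀ k x x' → mix′ k x (I x) ≡ mix′ k x' (I x') → I x ≡ I x'
    mix′-image-injective compatible k x x' eq
      with AgreeFrom⇒commonWindow k x x' (λ j k≤j → trans (sym (lookup-mix′-≥ k x (I x) j k≤j))
             (trans (cong (λ v → lookup v j) eq) (lookup-mix′-≥ k x' (I x') j k≤j)))
    ... | _ , wx , wx' = AgreeBelow∧∣index-index∣<⇒≡ k (I x) (I x')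
      (λ j j<k → trans (sym (lookup-mix′-< k x (I x) j j<k))
                       (trans (cong (λ v → lookup v j) eq) (lookup-mix′-< k x' (I x') j j<k)))
      (≤-<-trans (compatible x x') (InWindow⇒∣-∣< wx wx'))

    sweepFunction : Fin n → Vec (Fin s) n → Fin s
    sweepFunction i v with ∃-Vec? n (λ x → mix i x (I x) ≡ v) (λ x → ≡-dec F._≟_ (mix i x (I x)) v)
    ... | yes (x , _) = lookup (I x) i
    ... | no _        = lookup v i

    sweepFunction-spec : DistanceCompatible I →
                         ∀ x i → sweepFunction i (mix i x (I x)) ≡ lookup (I x) i
    sweepFunction-spec compatible x i
      with ∃-Vec? n (λ x' → mix i x' (I x') ≡ mix i x (I x)) (λ x' → ≡-dec F._≟_ (mix i x' (I x')) (mix i x (I x)))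
    ... | yes (x' , eq) = cong (λ v → lookup v i) (mix′-image-injective compatible (toℕ i) x' x eq)
    ... | no ∄x'        = ⊥-elim (∄x' (x , refl))

module _ {s n : ℕ} (p : Fin n → Vec (Fin s) n → Fin s) where

  signature-sweepProgram : signature (sweepProgram p) ≡ coords n
  signature-sweepProgram = trans (sym (map-∘ (coords n))) (map-id (coords n))

  run-sweep-from : ∀ {m} (f : Fin m → Fin n) k (x y : Vec (Fin s) n) →
                   (∀ i → p i (mix i x y) ≡ lookup y i) →
                   (∀ j → toℕ (f j) ≡ k + toℕ j) → k + m ≡ n →
                   foldl step (mix′ k x y) (L.map (λ i → (p i , i)) (toList (tabulate f))) ≡ y
  run-sweep-from {zero} f k x y _ _ k+0≡n = mix′-≥ k x y (≤-reflexive (trans (sym k+0≡n) (+-identityʳ k)))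
  run-sweep-from {suc m} f k x y spec f≗k+ k+m≡n =
    trans (cong (λ v → foldl step v (L.map (λ i → (p i , i)) (toList (tabulate (λ j → f (F.suc j)))))) first-step)
          (run-sweep-from (λ j → f (F.suc j)) (suc k) x y spec
                          (λ j → trans (f≗k+ (F.suc j)) (+-suc k (toℕ j))) (trans (sym (+-suc k m)) k+m≡n))
    where
    f0≡k : toℕ (f F.zero) ≡ k
    f0≡k = trans (f≗k+ F.zero) (+-identityʳ k)
    first-step : step (mix′ k x y) (p (f F.zero) , f F.zero) ≡ mix′ (suc k) x y
    first-step = trans (cong (mix′ k x y [ f F.zero ]≔_)
                             (subst (λ t → p (f F.zero) (mix′ t x y) ≡ lookup y (f F.zero)) f0≡k (spec (f F.zero))))
                       (mix′-update k x y (f F.zero) f0≡k)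

  run-sweepProgram : ∀ x y → (∀ i → p i (mix i x y) ≡ lookup y i) → run (sweepProgram p) x ≡ y
  run-sweepProgram x y spec = trans (cong (λ v → run (sweepProgram p) v) (sym (mix′-zero x y)))
                                    (run-sweep-from (λ j → j) 0 x y spec (λ _ → refl) refl)

proposition6 : (s n : ℕ) → 1 ≤ s → 1 ≤ n →
    (I : Vec (Fin s) n → Vec (Fin s) n) → DistanceCompatible I →
    Σ (Fin n → Vec (Fin s) n → Fin s) (λ p →
    (∀ (x : Vec (Fin s) n) (i : Fin n) → p i (mix i x (I x)) ≡ lookup (I x) i)
    × signature (sweepProgram p) ≡ coords n
    × Computes (sweepProgram p) I)
proposition6 (suc _) n _ _ I compatible =
  sweepFunction I , spec , signature-sweepProgram (sweepFunction I) ,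
  λ x → run-sweepProgram (sweepFunction I) x (I x) (spec x)
  where
  spec : ∀ x i → sweepFunction I i (mix i x (I x)) ≡ lookup (I x) i
  spec = sweepFunction-spec I compatible
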